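{- Let $n\ge 2$, let $p=p_1p_2\ldots p_n\in S_n$, and let $1\le j<k\le n$. Then $del(p,j)=del(p,k)$ if and only if $p_j$ and $p_k$ are part of the same run of $p$, i.e. $p_j,p_{j+1},\ldots,p_k$ is a run.
   Context: Permutations $p\in S_n$ are written in one-line notation $p=p_1p_2\ldots p_n$. For $i\in[n]=\{1,\ldots,n\}$, $del(p,i)\in S_{n-1}$ is the permutation obtained by deleting the $i$th entry of $p$ and relabelling the remaining entries $1$ through $n-1$ so that their relative order is preserved. A pair of adjacent entries $(p_i,p_{i+1})$ is a bond if $p_i-p_{i+1}=\pm1$. A sequence of consecutive entries $(p_i,p_{i+1},\ldots,p_{i+\ell-1})$ is a run (of length $\ell$) if each pair $(p_{i+t},p_{i+t+1})$, $0\le t\le \ell-2$, is a bond. -}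

module Defs where

open import Data.Nat using (ℕ; zero; suc; _<_; _≤_; _<ᵇ_)
open import Data.Nat.Properties using ()
open import Data.Fin using (Fin; toℕ)
open import Data.Fin.Permutation using (Permutation′; _⟨$⟩ʳ_)
open import Data.List using (List; []; _∷_; map; tabulate)
open import Data.Bool using (if_then_else_)
open import Data.Product using (Σ; _×_)
open import Data.Sum using (_⊎_)
open import Relation.Binary.PropositionalEquality using (_≡_)

-- One-line notation of a permutation of Fin n.  Values are 0-based
-- (entry p_i is represented by toℕ (p ⟨$⟩ʳ i) = p_i - 1); this shift
-- changes neither deletions' equality nor bonds.
oneLine : ∀ {n} → Permutation′ n → List ℕ
oneLine {n} p = tabulate (λ i → toℕ (p ⟨$⟩ʳ i))

removeAt : List ℕ → ℕ → List ℕ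
removeAt []       _       = []
removeAt (x ∷ xs) zero    = xs
removeAt (x ∷ xs) (suc i) = x ∷ removeAt xs i

-- entry at (0-based) position i (0 if out of range; never used out of range)
entryAt : List ℕ → ℕ → ℕ
entryAt []       _       = 0
entryAt (x ∷ xs) zero    = x
entryAt (x ∷ xs) (suc i) = entryAt xs i

-- standardisation after deleting value v: every entry larger than v drops by 1
relabel : ℕ → List ℕ → List ℕ
relabel v = map (λ x → if v <ᵇ x then Data.Nat.pred x else x)

del : ∀ {n} → Permutation′ n → Fin n → List ℕ
del p i = relabel (entryAt (oneLine p) (toℕ i)) (removeAt (oneLine p) (toℕ i))

Bond : ∀ {n} → Permutation′ n → Fin n → Fin n → Set
Bond p a b = (suc (toℕ (p ⟨$⟩ʳ a)) ≡ toℕ (p ⟨$⟩ʳ b)) ⊎ (suc (toℕ (p ⟨$⟩ʳ b)) ≡ toℕ (p ⟨$⟩ʳ a))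

IsRun : ∀ {n} → Permutation′ n → Fin n → Fin n → Set
IsRun {n} p j k = (t u : Fin n) → toℕ j ≤ toℕ t → toℕ t < toℕ k → toℕ u ≡ suc (toℕ t) → Bond p t u

-- Deleting p_i or p_(i+1) gives the same permutation exactly when they form
-- a bond: all other entries are relabelled alike, and the two entries that
-- survive at position i relabel to the same number.  Chaining this along a
-- run gives the "if" direction.  Conversely, if del(p,j) = del(p,k), then at
-- each position t with j ≤ t < k the first deletion shows (a relabelling of)
-- p_(t+1) and the second one p_t; two distinct numbers whose relabellings
-- agree differ by exactly one, so every such pair is a bond.
module Submission where

open import Defs
open import Data.Nat using (ℕ; zero; suc; pred; _≤_; _<_; _≤′_; _<ᵇ_; z≤n; s≤s; ≤′-refl; ≤′-step)
open import Data.Nat.Properties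
  using (<ᵇ⇒<; <⇒<ᵇ; ≤⇒≯; ≤∧≢⇒<; <-cmp; <⇒≤; m≤n⇒m≤1+n; n<1+n; n≤1+n; <-trans; ≤-trans; ≤⇒≤′; ≤′⇒≤)
open import Data.Bool using (true; false; if_then_else_; T)
open import Data.Unit using (tt)
open import Data.Empty using (⊥-elim)
open import Data.Fin using (Fin; toℕ; fromℕ<)
import Data.Fin as Fin
open import Data.Fin.Properties using (toℕ-injective; toℕ-fromℕ<; toℕ<n)
open import Data.Fin.Permutation using (Permutation′; _⟨$⟩ʳ_)
open import Data.List using (List; []; _∷_; length; tabulate)
open import Data.List.Properties using (length-tabulate; ∷-injective)
open import Data.List.Relation.Unary.All using (All; _∷_)
open import Data.List.Relation.Unary.AllPairs using (_∷_)
open import Data.List.Relation.Unary.Unique.Propositional using (Unique)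
open import Data.List.Relation.Unary.Unique.Propositional.Properties using (tabulate⁺)
open import Data.Product using (_×_; _,_; proj₁; proj₂)
open import Data.Sum using (_⊎_; inj₁; inj₂)
open import Relation.Binary using (tri<; tri≈; tri>)
open import Function using (id; _∘_; Injection)
open import Function.Properties.Inverse using (↔⇒↣)
open import Relation.Binary.PropositionalEquality

Adjacent : ℕ → ℕ → Set
Adjacent a b = (suc a ≡ b) ⊎ (suc b ≡ a)

lower : ℕ → ℕ → ℕ
lower v x = if v <ᵇ x then pred x else x

delete : List ℕ → ℕ → List ℕ
delete L i = relabel (entryAt L i) (removeAt L i)

AdjacentAt : List ℕ → ℕ → Set
AdjacentAt L t = Adjacent (entryAt L t) (entryAt L (suc t))

RunIn : List ℕ → ℕ → ℕ → Set
RunIn L j k = ∀ t → j ≤ t → t < k → AdjacentAt L t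

lower-> : ∀ {v x} → v < x → lower v x ≡ pred x
lower-> {v} {x} v<x with v <ᵇ x | <⇒<ᵇ v<x
... | true | _ = refl

lower-≤ : ∀ {v x} → x ≤ v → lower v x ≡ x
lower-≤ {v} {x} x≤v with v <ᵇ x in eq
... | false = refl
... | true  = ⊥-elim (≤⇒≯ x≤v (<ᵇ⇒< v x (subst T (sym eq) tt)))

lower-cases : ∀ v x → (lower v x ≡ x) ⊎ (suc (lower v x) ≡ x)
lower-cases v x with v <ᵇ x in eq
... | false = inj₁ refl
... | true with <ᵇ⇒< v x (subst T (sym eq) tt)
...   | s≤s _ = inj₂ refl

lower-suc-agree : ∀ x {z} → x ≢ z → suc x ≢ z → lower x z ≡ lower (suc x) z
lower-suc-agree x {z} x≢z sx≢z with <-cmp z x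
... | tri< z<x _ _ = trans (lower-≤ (<⇒≤ z<x)) (sym (lower-≤ (m≤n⇒m≤1+n (<⇒≤ z<x))))
... | tri≈ _ z≡x _ = ⊥-elim (x≢z (sym z≡x))
... | tri> _ _ x<z = trans (lower-> x<z) (sym (lower-> (≤∧≢⇒< x<z sx≢z)))

lower-agree : ∀ {x y z} → Adjacent x y → x ≢ z → y ≢ z → lower x z ≡ lower y z
lower-agree {x} (inj₁ refl) x≢z y≢z = lower-suc-agree x x≢z y≢z
lower-agree {y = y} (inj₂ refl) x≢z y≢z = sym (lower-suc-agree y y≢z x≢z)

lower-swap : ∀ {x y} → Adjacent x y → lower x y ≡ lower y x
lower-swap {x} (inj₁ refl) = trans (lower-> (n<1+n x)) (sym (lower-≤ (n≤1+n x)))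
lower-swap {y = y} (inj₂ refl) = trans (lower-≤ (n≤1+n y)) (sym (lower-> (n<1+n y)))

lower-≡⇒Adjacent : ∀ {v w a b} → lower v a ≡ lower w b → b ≢ a → Adjacent b a
lower-≡⇒Adjacent {v} {w} {a} {b} eq b≢a with lower-cases v a | lower-cases w b
... | inj₁ a↦a  | inj₁ b↦b  = ⊥-elim (b≢a (trans (sym b↦b) (trans (sym eq) a↦a)))
... | inj₁ a↦a  | inj₂ b↦b-1 = inj₂ (trans (cong suc (trans (sym a↦a) eq)) b↦b-1)
... | inj₂ a↦a-1 | inj₁ b↦b  = inj₁ (trans (cong suc (trans (sym b↦b) (sym eq))) a↦a-1)
... | inj₂ a↦a-1 | inj₂ b↦b-1 = ⊥-elim (b≢a (trans (sym b↦b-1) (trans (cong suc (sym eq)) a↦a-1)))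

relabel-agree : ∀ {x y} zs → Adjacent x y → All (x ≢_) zs → All (y ≢_) zs → relabel x zs ≡ relabel y zs
relabel-agree []       _   _            _            = refl
relabel-agree (z ∷ zs) x~y (x≢z ∷ x≢zs) (y≢z ∷ y≢zs) =
  cong₂ _∷_ (lower-agree x~y x≢z y≢z) (relabel-agree zs x~y x≢zs y≢zs)

All-entryAt : ∀ {P : ℕ → Set} {xs i} → All P xs → i < length xs → P (entryAt xs i)
All-entryAt {xs = _ ∷ _} {zero}  (px ∷ _)  _         = px
All-entryAt {xs = _ ∷ _} {suc i} (_ ∷ pxs) (s≤s i<n) = All-entryAt pxs i<n

delete-adjacent : ∀ {L} i → Unique L → suc i < length L →
  AdjacentAt L i → delete L i ≡ delete L (suc i)
delete-adjacent {x ∷ y ∷ zs} zero ((_ ∷ x≢zs) ∷ (y≢zs ∷ _)) _ x~y =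
  cong₂ _∷_ (lower-swap x~y) (relabel-agree zs x~y x≢zs y≢zs)
delete-adjacent {z ∷ zs} (suc i) (z≢zs ∷ u) (s≤s i+1<n) x~y =
  cong₂ _∷_ (lower-agree x~y (≢-sym (All-entryAt z≢zs (<-trans (n<1+n i) i+1<n)))
                                 (≢-sym (All-entryAt z≢zs i+1<n)))
            (delete-adjacent i u i+1<n x~y)

delete-run : ∀ {L j k} → Unique L → k < length L → j ≤′ k → RunIn L j k → delete L j ≡ delete L k
delete-run _ _ ≤′-refl _ = refl
delete-run {k = suc m} u m+1<n (≤′-step j≤′m) run =
  trans (delete-run u (<-trans (n<1+n m) m+1<n) j≤′m (λ t j≤t t<m → run t j≤t (<-trans t<m (n<1+n m))))
        (delete-adjacent m u m+1<n (run m (≤′⇒≤ j≤′m) (n<1+n m)))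

relabel-shift-run : ∀ {v w c zs} k → Unique (c ∷ zs) →
  relabel v zs ≡ relabel w (c ∷ removeAt zs k) → RunIn (c ∷ zs) 0 (suc k)
relabel-shift-run {zs = []} _ _ ()
relabel-shift-run {zs = z ∷ zs} k ((c≢z ∷ _) ∷ _) eq zero _ _ =
  lower-≡⇒Adjacent (proj₁ (∷-injective eq)) c≢z
relabel-shift-run {zs = z ∷ zs} (suc k) (_ ∷ u) eq (suc t) _ (s≤s t<k+1) =
  relabel-shift-run k u (proj₂ (∷-injective eq)) t z≤n t<k+1

delete-≡⇒run : ∀ {L j k} → Unique L → j < k → k < length L → delete L j ≡ delete L k → RunIn L j k
delete-≡⇒run {_ ∷ _} {zero} {suc k} u _ _ eq = relabel-shift-run k u eq
delete-≡⇒run {_ ∷ _} {suc j} {suc k} (_ ∷ u) (s≤s j<k) (s≤s k<n) eq (suc t) (s≤s j≤t) (s≤s t<k) =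
  delete-≡⇒run u j<k k<n (proj₂ (∷-injective eq)) t j≤t t<k

entryAt-tabulate : ∀ {n} (f : Fin n → ℕ) i → entryAt (tabulate f) (toℕ i) ≡ f i
entryAt-tabulate f Fin.zero    = refl
entryAt-tabulate f (Fin.suc i) = entryAt-tabulate (f ∘ Fin.suc) i

module _ {n} (p : Permutation′ n) where

  entryAt-oneLine : ∀ i → entryAt (oneLine p) (toℕ i) ≡ toℕ (p ⟨$⟩ʳ i)
  entryAt-oneLine = entryAt-tabulate (λ i → toℕ (p ⟨$⟩ʳ i))

  oneLine-unique : Unique (oneLine p)
  oneLine-unique = tabulate⁺ {f = λ i → toℕ (p ⟨$⟩ʳ i)} (Injection.injective (↔⇒↣ p) ∘ toℕ-injective)

  toℕ<length-oneLine : ∀ i → toℕ i < length (oneLine p)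
  toℕ<length-oneLine i = subst (toℕ i <_) (sym (length-tabulate (λ i → toℕ (p ⟨$⟩ʳ i)))) (toℕ<n i)

  Bond≡AdjacentAt : ∀ {t u} → toℕ u ≡ suc (toℕ t) → Bond p t u ≡ AdjacentAt (oneLine p) (toℕ t)
  Bond≡AdjacentAt {t} {u} u≡t+1 = cong₂ Adjacent (sym (entryAt-oneLine t))
    (trans (sym (entryAt-oneLine u)) (cong (entryAt (oneLine p)) u≡t+1))

  IsRun⇒RunIn : ∀ {j k} → IsRun p j k → RunIn (oneLine p) (toℕ j) (toℕ k)
  IsRun⇒RunIn {k = k} run t j≤t t<k with fromℕ< t<n | toℕ-fromℕ< t<n
    where
    t<n : t < n
    t<n = <-trans t<k (toℕ<n k)
  ... | t′ | refl = subst id (Bond≡AdjacentAt u≡t′+1) (run t′ u j≤t t<k u≡t′+1)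
    where
    t′+1<n : suc (toℕ t′) < n
    t′+1<n = ≤-trans (s≤s t<k) (toℕ<n k)
    u : Fin n
    u = fromℕ< t′+1<n
    u≡t′+1 : toℕ u ≡ suc (toℕ t′)
    u≡t′+1 = toℕ-fromℕ< t′+1<n

  RunIn⇒IsRun : ∀ {j k} → RunIn (oneLine p) (toℕ j) (toℕ k) → IsRun p j k
  RunIn⇒IsRun run t u j≤t t<k u≡t+1 = subst id (sym (Bond≡AdjacentAt u≡t+1)) (run (toℕ t) j≤t t<k)

lemma1 : (n : ℕ) → 2 ≤ n → (p : Permutation′ n) → (j k : Fin n) → toℕ j < toℕ k →
    (del p j ≡ del p k → IsRun p j k) × (IsRun p j k → del p j ≡ del p k)
lemma1 n _ p j k j<k =
  (λ del≡ → RunIn⇒IsRun p (delete-≡⇒run (oneLine-unique p) j<k k<length del≡)) ,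
  (λ run → delete-run (oneLine-unique p) k<length (≤⇒≤′ (<⇒≤ j<k)) (IsRun⇒RunIn p run))
  where
  k<length : toℕ k < length (oneLine p)
  k<length = toℕ<length-oneLine p k
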